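{- Let $G=(V,E)$ be an $n$-node graph of diameter $D$, let $F\subseteq E$, and let $u,v\in V$ be connected in $G\setminus F$. Then $\mathrm{dist}_{G\setminus F}(u,v)\le 2(|F|+1)\cdot D+|F|$. -}

module Defs where

open import Data.Nat using (ℕ; zero; suc; _<_)
open import Data.Fin using (Fin)
open import Data.Product using (_×_; _,_; ∃; ∃-syntax)
open import Data.Sum using (_⊎_)
open import Data.List using (List)
open import Data.List.Membership.Propositional using (_∈_)
open import Data.List.Relation.Unary.All using (All)
open import Data.List.Relation.Unary.AllPairs using (AllPairs)
open import Relation.Nullary using (¬_)
open import Relation.Binary.PropositionalEquality using (_≡_)

-- An (undirected, simple) graph on vertex set Fin n, given by its edge list.
-- An edge (a , b) stands for the unordered edge {a , b}.
Edge : ℕ → Set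
Edge n = Fin n × Fin n

SameEdge : ∀ {n} → Edge n → Edge n → Set
SameEdge (a , b) (c , d) = ((a ≡ c) × (b ≡ d)) ⊎ ((a ≡ d) × (b ≡ c))

_∈E_ : ∀ {n} → Edge n → List (Edge n) → Set
e ∈E E = ∃[ e' ] (e' ∈ E × SameEdge e e')

Adj : ∀ {n} → List (Edge n) → Fin n → Fin n → Set
Adj E u v = (u , v) ∈E E

AdjMinus : ∀ {n} → List (Edge n) → List (Edge n) → Fin n → Fin n → Set
AdjMinus E F u v = Adj E u v × ¬ ((u , v) ∈E F)

data Walk {n : ℕ} (R : Fin n → Fin n → Set) : Fin n → Fin n → ℕ → Set where
  nil  : ∀ {u} → Walk R u u zero
  cons : ∀ {u w v k} → R u w → Walk R w v k → Walk R u v (suc k)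

Connected : ∀ {n} → (Fin n → Fin n → Set) → Fin n → Fin n → Set
Connected R u v = ∃[ k ] Walk R u v k

IsDist : ∀ {n} → (Fin n → Fin n → Set) → Fin n → Fin n → ℕ → Set
IsDist R u v d = Walk R u v d × (∀ k → k < d → ¬ Walk R u v k)

IsDiameter : ∀ {n} → (Fin n → Fin n → Set) → ℕ → Set
IsDiameter {n} R D =
  (∀ (u v : Fin n) → ∃[ d ] (IsDist R u v d × d Data.Nat.≤ D))
  × ∃[ u ] ∃[ v ] IsDist R u v D

SimpleEdges : ∀ {n} → List (Edge n) → Set
SimpleEdges E = All (λ { (a , b) → ¬ (a ≡ b) }) E × AllPairs (λ e e' → ¬ SameEdge e e') E

-- F ⊆ E with F a set of distinct edges (so |F| = length F)
EdgeSubset : ∀ {n} → List (Edge n) → List (Edge n) → Set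
EdgeSubset F E = All (λ e → e ∈E E) F × AllPairs (λ e e' → ¬ SameEdge e e') F

{-# OPTIONS --safe #-}
module Submission where

-- Fix the root u.  Every vertex x reaches u by a shortest path of G, of length ≤ D;
-- colour x by the first F-edge on it, or by a fresh colour if there is none.  Two vertices
-- of the same colour are joined in G ∖ F by a walk of length ≤ 2D, so on a shortest u–v
-- path of G ∖ F equally coloured vertices are at most 2D apart, and by pigeonhole
-- its length is below (|F| + 1)(2D + 1).

open import Defs
open import Data.Nat using (ℕ; _+_; _*_; _≤_)
open import Data.Fin using (Fin)
open import Data.List using (List; length)

open import Data.Nat using (zero; suc; _<_; _∸_; z≤n; s≤s)
open import Data.Nat.Properties
open import Data.Nat.Solver using (module +-*-Solver)
open import Data.Fin using (toℕ)
import Data.Fin.Properties as Fin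
open import Data.Product using (_×_; _,_; proj₁; proj₂; ∃-syntax)
open import Data.Sum using (inj₁; inj₂)
open import Data.Empty using (⊥-elim)
open import Data.List using (lookup)
open import Data.List.Membership.Propositional using (lose)
open import Data.List.Relation.Unary.Any as Any using (Any; any?)
open import Data.List.Relation.Unary.Any.Properties using (lookup-index)
open import Relation.Nullary using (Dec; yes; no; contradiction)
open import Relation.Nullary.Decidable using (_×-dec_; _⊎-dec_)
open import Relation.Binary.PropositionalEquality

module _ {n : ℕ} {R : Fin n → Fin n → Set} where

  _++ᵂ_ : ∀ {u v x k j} → Walk R u v k → Walk R v x j → Walk R u x (k + j)
  nil      ++ᵂ V = V
  cons r W ++ᵂ V = cons r (W ++ᵂ V)

  snoc : ∀ {u v x k} → Walk R u v k → R v x → Walk R u x (suc k)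
  snoc nil        r = cons r nil
  snoc (cons s W) r = cons s (snoc W r)

  reverse : (∀ {a b} → R a b → R b a) → ∀ {u v k} → Walk R u v k → Walk R v u k
  reverse sym nil        = nil
  reverse sym (cons r W) = snoc (reverse sym W) (sym r)

  vertexAt : ∀ {u v k} → Walk R u v k → ℕ → Fin n
  vertexAt {u} nil        _       = u
  vertexAt {u} (cons _ _) zero    = u
  vertexAt     (cons _ W) (suc i) = vertexAt W i

  take : ∀ {u v k} (W : Walk R u v k) a → a ≤ k → Walk R u (vertexAt W a) a
  take nil        zero    _       = nil
  take (cons r W) zero    _       = nil
  take (cons r W) (suc a) (s≤s h) = cons r (take W a h)

  drop : ∀ {u v k} (W : Walk R u v k) a → a ≤ k → Walk R (vertexAt W a) v (k ∸ a)
  drop nil        zero    _       = nil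
  drop (cons r W) zero    _       = cons r W
  drop (cons r W) (suc a) (s≤s h) = drop W a h

  next : ∀ {u v k} → Walk R u v (suc k) → Fin n
  next (cons {w = x} _ _) = x

  next-step : ∀ {u v k} (W : Walk R u v (suc k)) → R u (next W)
  next-step (cons r _) = r

  next-tail : ∀ {u v k} (W : Walk R u v (suc k)) → Walk R (next W) v k
  next-tail (cons _ W) = W

  dist≤length : ∀ {u v d k} → IsDist R u v d → Walk R u v k → d ≤ k
  dist≤length {d = d} {k} (_ , minimal) W with d ≤? k
  ... | yes d≤k = d≤k
  ... | no  d≰k = contradiction W (minimal k (≰⇒> d≰k))

  shortcut : ∀ {u v d m} (W : Walk R u v d) a b → a ≤ b → b ≤ d →
             Walk R (vertexAt W a) (vertexAt W b) m → Walk R u v (a + (m + (d ∸ b)))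
  shortcut W a b a≤b b≤d V = take W a (≤-trans a≤b b≤d) ++ᵂ (V ++ᵂ drop W b b≤d)

  shortcut-shorter : ∀ a b {d m} → a + m < b → b ≤ d → a + (m + (d ∸ b)) < d
  shortcut-shorter a b {d} {m} a+m<b b≤d = begin-strict
    a + (m + (d ∸ b)) ≡⟨ +-assoc a m (d ∸ b) ⟨
    a + m + (d ∸ b)   <⟨ +-monoˡ-< (d ∸ b) a+m<b ⟩
    b + (d ∸ b)       ≡⟨ m+[n∸m]≡n b≤d ⟩
    d                 ∎
    where open ≤-Reasoning

  -- Sample the shortest walk every L+1 steps: if it had length ≥ k(L+1), two of the
  -- k+1 samples would share a colour and could be joined by a walk shorter than the gap.
  dist<colours*suc : ∀ {k L u v d} (colour : Fin n → Fin k) →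
    (∀ x y → colour x ≡ colour y → ∃[ m ] (m ≤ L × Walk R x y m)) →
    IsDist R u v d → d < k * suc L
  dist<colours*suc {k} {L} {d = d} colour join (W , minimal) with k * suc L ≤? d
  ... | no  k[L+1]≰d = ≰⇒> k[L+1]≰d
  ... | yes k[L+1]≤d = contradiction (shortcut W (pos i) (pos j) a≤b (pos≤d j) V)
                                     (minimal _ (shortcut-shorter (pos i) (pos j) a+m<b (pos≤d j)))
    where
    pos : Fin (suc k) → ℕ
    pos i = toℕ i * suc L
    pos≤d : ∀ i → pos i ≤ d
    pos≤d i = ≤-trans (*-monoˡ-≤ (suc L) (≤-pred (Fin.toℕ<n i))) k[L+1]≤d
    sample : Fin (suc k) → Fin n
    sample i = vertexAt W (pos i)
    collision = Fin.pigeonhole (n<1+n k) (λ i → colour (sample i))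
    i = proj₁ collision
    j = proj₁ (proj₂ collision)
    joined = join (sample i) (sample j) (proj₂ (proj₂ (proj₂ collision)))
    V = proj₂ (proj₂ joined)
    a+m<b : pos i + proj₁ joined < pos j
    a+m<b = begin-strict
      pos i + proj₁ joined <⟨ +-monoʳ-< (pos i) (s≤s (proj₁ (proj₂ joined))) ⟩
      pos i + suc L        ≡⟨ +-comm (pos i) (suc L) ⟩
      suc L + pos i        ≤⟨ *-monoˡ-≤ (suc L) (proj₁ (proj₂ (proj₂ collision))) ⟩
      pos j                ∎
      where open ≤-Reasoning
    a≤b : pos i ≤ pos j
    a≤b = ≤-trans (m≤m+n (pos i) _) (<⇒≤ a+m<b)

SameEdge-sym : ∀ {n} {e e′ : Edge n} → SameEdge e e′ → SameEdge e′ e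
SameEdge-sym {e = _ , _} {_ , _} (inj₁ (refl , refl)) = inj₁ (refl , refl)
SameEdge-sym {e = _ , _} {_ , _} (inj₂ (refl , refl)) = inj₂ (refl , refl)

SameEdge-trans : ∀ {n} {e e′ e″ : Edge n} → SameEdge e e′ → SameEdge e′ e″ → SameEdge e e″
SameEdge-trans {e = _ , _} {_ , _} {_ , _} (inj₁ (refl , refl)) s = s
SameEdge-trans {e = _ , _} {_ , _} {_ , _} (inj₂ (refl , refl)) (inj₁ (refl , refl)) = inj₂ (refl , refl)
SameEdge-trans {e = _ , _} {_ , _} {_ , _} (inj₂ (refl , refl)) (inj₂ (refl , refl)) = inj₁ (refl , refl)

SameEdge? : ∀ {n} (e e′ : Edge n) → Dec (SameEdge e e′)
SameEdge? (a , b) (c , d) = ((a Fin.≟ c) ×-dec (b Fin.≟ d)) ⊎-dec ((a Fin.≟ d) ×-dec (b Fin.≟ c))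

∈E-swap : ∀ {n} {a b : Fin n} {E} → (a , b) ∈E E → (b , a) ∈E E
∈E-swap (e , e∈E , s) = e , e∈E , SameEdge-trans (inj₂ (refl , refl)) s

∈E⇒Any : ∀ {n} {e : Edge n} {F} → e ∈E F → Any (SameEdge e) F
∈E⇒Any (_ , e′∈F , s) = lose e′∈F s

AdjMinus-sym : ∀ {n} {E F : List (Edge n)} {a b} → AdjMinus E F a b → AdjMinus E F b a
AdjMinus-sym (adj , ∉F) = ∈E-swap adj , λ ∈F → ∉F (∈E-swap ∈F)

-- An F-edge is only ever crossed from its endpoint farther from w, so the index of the
-- edge in F determines the vertex where the walk towards w stops.
module ExitColouring {n : ℕ} (E F : List (Edge n)) (w : Fin n)
  (toRoot : ∀ x → ∃[ d ] IsDist (Adj E) x w d) where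

  depth : Fin n → ℕ
  depth x = proj₁ (toRoot x)

  shortestPath : ∀ x → Walk (Adj E) x w (depth x)
  shortestPath x = proj₁ (proj₂ (toRoot x))

  data Step (x : Fin n) : Set where
    atRoot : x ≡ w → Step x
    closer : (p : Fin n) → Adj E x p → depth p < depth x → Step x

  step : ∀ x → Step x
  step x with depth x in eq | shortestPath x
  ... | zero  | nil = atRoot refl
  ... | suc k | W   = closer (next W) (next-step W) (begin-strict
    depth (next W) ≤⟨ dist≤length (proj₂ (toRoot (next W))) (next-tail W) ⟩
    k              <⟨ n<1+n k ⟩
    suc k          ≡⟨ eq ⟨
    depth x        ∎)
    where open ≤-Reasoning

  data Exit : Fin n → Set where
    root : Exit w
    cut  : ∀ {c p} → depth p < depth c → Any (SameEdge (c , p)) F → Exit c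

  exitColour : ∀ {t} → Exit t → Fin (suc (length F))
  exitColour root        = Fin.zero
  exitColour (cut _ c∈F) = Fin.suc (Any.index c∈F)

  exitColour-injective : ∀ {t t′} (e : Exit t) (e′ : Exit t′) →
                         exitColour e ≡ exitColour e′ → t ≡ t′
  exitColour-injective root root _ = refl
  exitColour-injective (cut lt c∈F) (cut lt′ c′∈F) same
    with SameEdge-trans (lookup-index c∈F)
           (SameEdge-sym (subst (λ i → SameEdge _ (lookup F i))
                                (sym (Fin.suc-injective same)) (lookup-index c′∈F)))
  ... | inj₁ (c≡c′ , _)    = c≡c′
  ... | inj₂ (refl , refl) = ⊥-elim (<-asym lt lt′)

  record Anchor (x : Fin n) : Set where
    field
      {target} : Fin n
      exit     : Exit target
      reach    : ∃[ m ] (m ≤ depth x × Walk (AdjMinus E F) x target m)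

  anchor : ∀ k x → depth x < k → Anchor x
  anchor (suc k) x (s≤s d≤k) with step x
  ... | atRoot refl = record { exit = root ; reach = 0 , z≤n , nil }
  ... | closer p adj lt with any? (SameEdge? (x , p)) F
  ... | yes cut-edge = record { exit = cut lt cut-edge ; reach = 0 , z≤n , nil }
  ... | no  not-cut  =
    let record { exit = e ; reach = m , m≤ , W } = anchor k p (≤-trans lt d≤k)
    in  record { exit = e
               ; reach = suc m , ≤-trans (s≤s m≤) lt
                       , cons (adj , λ ∈F → not-cut (∈E⇒Any ∈F)) W }

  anchorOf : ∀ x → Anchor x
  anchorOf x = anchor (suc (depth x)) x ≤-refl

  colour : Fin n → Fin (suc (length F))
  colour x = exitColour (Anchor.exit (anchorOf x))

  sameColour⇒walk : ∀ x y → colour x ≡ colour y →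
                    ∃[ m ] (m ≤ depth x + depth y × Walk (AdjMinus E F) x y m)
  sameColour⇒walk x y same
    with anchorOf x | anchorOf y
       | exitColour-injective (Anchor.exit (anchorOf x)) (Anchor.exit (anchorOf y)) same
  ... | record { reach = m , m≤ , W } | record { reach = m′ , m′≤ , W′ } | refl =
    m + m′ , +-mono-≤ m≤ m′≤ , W ++ᵂ reverse AdjMinus-sym W′

suc[2*[f+1]*D+f]≡suc[f]*suc[D+D] : ∀ f D → suc (2 * (f + 1) * D + f) ≡ suc f * suc (D + D)
suc[2*[f+1]*D+f]≡suc[f]*suc[D+D] = solve 2
  (λ f D → con 1 :+ (con 2 :* (f :+ con 1) :* D :+ f) := (con 1 :+ f) :* (con 1 :+ (D :+ D))) refl
  where open +-*-Solver

mainTheorem4 : (n D : ℕ) (E F : List (Edge n)) → SimpleEdges E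
    → IsDiameter (Adj E) D → EdgeSubset F E
    → (u v : Fin n) → Connected (AdjMinus E F) u v
    → ∀ d → IsDist (AdjMinus E F) u v d
    → d ≤ 2 * (length F + 1) * D + length F
mainTheorem4 n D E F _ (close , _) _ u v _ d dist =
  ≤-pred (subst (d <_) (sym (suc[2*[f+1]*D+f]≡suc[f]*suc[D+D] (length F) D))
                (dist<colours*suc colour join dist))
  where
  toRoot : ∀ x → ∃[ d ] IsDist (Adj E) x u d
  toRoot x = proj₁ (close x u) , proj₁ (proj₂ (close x u))

  open ExitColouring E F u toRoot

  join : ∀ x y → colour x ≡ colour y → ∃[ m ] (m ≤ D + D × Walk (AdjMinus E F) x y m)
  join x y same with sameColour⇒walk x y same
  ... | m , m≤ , W = m , ≤-trans m≤ (+-mono-≤ (depth≤D x) (depth≤D y)) , W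
    where
    depth≤D : ∀ z → depth z ≤ D
    depth≤D z = proj₂ (proj₂ (close z u))
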